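{- For every $k\ge 7$, let $C_k$ be the cycle on $k$ vertices and $G=KB(C_k)$. Then for every vertex $q$ of $G$, the graph $G-\{q\}$ is not a biclique graph.
   Context: All graphs are finite, simple and undirected. A biclique of a graph $H$ is a maximal (with respect to inclusion) set of vertices inducing a complete bipartite subgraph (with both parts nonempty). The biclique graph $KB(H)$ is the intersection graph of the family of all bicliques of $H$: its vertices are the bicliques of $H$, and two are adjacent iff they share at least one vertex. A graph $G$ is a biclique graph if $G\cong KB(H)$ for some graph $H$. -}

module Defs where

open import Level using (Level; suc; zero)
open import Data.Nat as ℕ using (ℕ; _≤_; s≤s; z≤n)
open import Data.Nat.Properties using (1+n≢n)
open import Data.Fin using (Fin; toℕ)
open import Data.Fin.Subset using (Subset; _∈_; _⊆_; _∩_; _∪_; ⊥; Nonempty)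
open import Data.Product using (Σ; ∃; _×_; _,_; proj₁; proj₂)
open import Data.Sum using (_⊎_; inj₁; inj₂)
open import Relation.Nullary using (¬_)
open import Relation.Binary.PropositionalEquality using (_≡_; refl; trans; cong) renaming (sym to ≡-sym)

record SimpleGraph (n : ℕ) : Set₁ where
  field
    Adj    : Fin n → Fin n → Set
    sym    : ∀ {x y} → Adj x y → Adj y x
    irrefl : ∀ {x} → ¬ Adj x x

open SimpleGraph public

InducesCompleteBipartite : ∀ {n} → SimpleGraph n → Subset n → Set
InducesCompleteBipartite {n} H S =
  Σ (Subset n) λ X → Σ (Subset n) λ Y →
    Nonempty X × Nonempty Y × (X ∩ Y ≡ ⊥) × (X ∪ Y ≡ S)
    × (∀ {x y} → x ∈ X → y ∈ X → ¬ Adj H x y)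
    × (∀ {x y} → x ∈ Y → y ∈ Y → ¬ Adj H x y)
    × (∀ {x y} → x ∈ X → y ∈ Y → Adj H x y)

IsBiclique : ∀ {n} → SimpleGraph n → Subset n → Set
IsBiclique {n} H S =
  InducesCompleteBipartite H S
  × (∀ (T : Subset n) → S ⊆ T → InducesCompleteBipartite H T → T ≡ S)

-- General graphs whose vertex type carries an explicit vertex identity _≈_
-- (needed because vertices of KB(H) are bicliques, i.e. subsets, paired
-- with proofs; vertex identity is equality of the subsets).

record Graph : Set₁ where
  field
    V   : Set
    _≈_ : V → V → Set
    E   : V → V → Set

open Graph public

record _≅_ (G G' : Graph) : Set where
  field
    f     : V G → V G'
    resp  : ∀ {u v} → _≈_ G u v → _≈_ G' (f u) (f v)
    inj   : ∀ {u v} → _≈_ G' (f u) (f v) → _≈_ G u v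
    surj  : ∀ (w : V G') → Σ (V G) λ v → _≈_ G' (f v) w
    edge→ : ∀ {u v} → E G u v → E G' (f u) (f v)
    edge← : ∀ {u v} → E G' (f u) (f v) → E G u v

KB : ∀ {n} → SimpleGraph n → Graph
KB {n} H = record
  { V   = Σ (Subset n) (IsBiclique H)
  ; _≈_ = λ a b → proj₁ a ≡ proj₁ b
  ; E   = λ a b → ¬ (proj₁ a ≡ proj₁ b) × Nonempty (proj₁ a ∩ proj₁ b)
  }

deleteVertex : (G : Graph) → V G → Graph
deleteVertex G q = record
  { V   = Σ (V G) λ v → ¬ (_≈_ G v q)
  ; _≈_ = λ a b → _≈_ G (proj₁ a) (proj₁ b)
  ; E   = λ a b → E G (proj₁ a) (proj₁ b)
  }

IsBicliqueGraph : Graph → Set₁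
IsBicliqueGraph G = Σ ℕ λ n → Σ (SimpleGraph n) λ H → G ≅ KB H

CycleAdj : (k : ℕ) → Fin k → Fin k → Set
CycleAdj k i j =
  (ℕ.suc (toℕ i) ≡ toℕ j) ⊎ (ℕ.suc (toℕ j) ≡ toℕ i)
  ⊎ (ℕ.suc (toℕ i) ≡ k × toℕ j ≡ 0) ⊎ (ℕ.suc (toℕ j) ≡ k × toℕ i ≡ 0)

private
  cycSym : ∀ {k i j} → CycleAdj k i j → CycleAdj k j i
  cycSym (inj₁ p) = inj₂ (inj₁ p)
  cycSym (inj₂ (inj₁ p)) = inj₁ p
  cycSym (inj₂ (inj₂ (inj₁ p))) = inj₂ (inj₂ (inj₂ p))
  cycSym (inj₂ (inj₂ (inj₂ p))) = inj₂ (inj₂ (inj₁ p))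

  k≢1 : ∀ {k} → 3 ≤ k → ¬ (k ≡ 1)
  k≢1 (s≤s (s≤s _)) ()

  cycIrr : ∀ {k} → 3 ≤ k → ∀ {i} → ¬ CycleAdj k i i
  cycIrr h {i} (inj₁ p) = 1+n≢n p
  cycIrr h {i} (inj₂ (inj₁ p)) = 1+n≢n p
  cycIrr h {i} (inj₂ (inj₂ (inj₁ (p , q)))) = k≢1 h (trans (≡-sym p) (cong ℕ.suc q))
  cycIrr h {i} (inj₂ (inj₂ (inj₂ (p , q)))) = k≢1 h (trans (≡-sym p) (cong ℕ.suc q))

cycle : (k : ℕ) → 3 ≤ k → SimpleGraph k
cycle k h = record { Adj = CycleAdj k ; sym = cycSym ; irrefl = cycIrr h }

3≤7+ : ∀ {k} → 7 ≤ k → 3 ≤ k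
3≤7+ (s≤s (s≤s (s≤s _))) = s≤s (s≤s (s≤s z≤n))

-- The bicliques of C_k are exactly its k induced paths on three vertices, the arcs
-- {x, x+1, x+2}, and for k ≥ 7 two arcs meet iff their starting points are at most 2 apart.
-- Suppose G − q ≅ KB(H) with q = arc(P+1), and let D, B, C be the bicliques of H that
-- correspond to arc P, arc(P+2) and arc(P+3).  In G − q the edge BD lies in no triangle
-- (its only common neighbour was q), while C is adjacent to B but not to D.  This cannot
-- happen in a biclique graph: if bicliques B and D of H meet and no third biclique meets
-- both, then every biclique meeting B also meets D.  For v ∈ B ∩ D, using that every edge
-- and every induced path on three vertices extends to a biclique, either all neighbours of
-- v in D lie in B or all neighbours of v in B lie in D, and a vertex of C ∩ B contradicts both.

module Submission where

open import Defs
open import Data.Nat using (ℕ; _≤_)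
open import Relation.Nullary using (¬_)

open import Data.Bool.Properties using () renaming (_≟_ to _≟ᵇ_)
open import Data.Empty using (⊥; ⊥-elim)
open import Data.Fin using (Fin; toℕ; fromℕ<)
open import Data.Fin.Properties using (toℕ-fromℕ<; toℕ-injective; toℕ<n; _≟_; any?)
open import Data.Fin.Subset using (Subset; _∈_; _∉_; _⊆_; _⊂_; _⊃_; _∩_; _∪_; Nonempty; ⁅_⁆) renaming (⊥ to ∅)
open import Data.Fin.Subset.Induction using (⊃-wellFounded; Acc; acc)
open import Data.Fin.Subset.Properties
  using (_∈?_; x∈p∪q⁻; x∈p∪q⁺; x∈p∩q⁻; x∈p∩q⁺; ∉⊥; x∈⁅x⁆; x∈⁅y⁆⇒x≡y; ⊆-antisym; nonempty?)
open import Data.Nat using (_<_; _+_; _*_; _∸_; zero; suc; s≤s; z≤n; NonZero; >-nonZero)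
open import Data.Nat.DivMod
  using (_%_; m%n<n; m<n⇒m%n≡m; n%n≡0; %-distribˡ-+; m%n%n≡m%n; [m+n]%n≡m%n; [m+kn]%n≡m%n)
open import Data.Nat.Properties
  using ( +-comm; +-assoc; +-suc; +-identityʳ; *-suc; ≤-trans; ≤-refl; ≤-antisym; m≤n+m; +-mono-≤
        ; m+[n∸m]≡n; m∸n≤m; m≤n⇒m<n∨m≡n; <⇒≢; <⇒≱)
open import Data.Product using (∃; ∃₂; _×_; _,_; proj₁; proj₂)
open import Data.Sum using (_⊎_; inj₁; inj₂; [_,_]′; map₁; swap)
open import Data.Vec.Properties using (≡-dec)
open import Function using (id; _∘_)
open import Relation.Binary using (DecidableEquality)
open import Relation.Binary.PropositionalEquality
  using (_≡_; _≢_; refl; trans; cong; subst; module ≡-Reasoning) renaming (sym to ≡-sym)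
open import Relation.Nullary using (Dec; yes; no)
open import Relation.Nullary.Decidable using (decidable-stable; ¬¬-excluded-middle; map′; _⊎-dec_; _×-dec_)

[m+n%d]%d≡[m+n]%d : ∀ m n d .{{_ : NonZero d}} → (m + n % d) % d ≡ (m + n) % d
[m+n%d]%d≡[m+n]%d m n d = begin
  (m + n % d) % d         ≡⟨ %-distribˡ-+ m (n % d) d ⟩
  (m % d + n % d % d) % d ≡⟨ cong (λ r → (m % d + r) % d) (m%n%n≡m%n n d) ⟩
  (m % d + n % d) % d     ≡⟨ %-distribˡ-+ m n d ⟨
  (m + n) % d             ∎
  where open ≡-Reasoning

[m%d+n]%d≡[m+n]%d : ∀ m n d .{{_ : NonZero d}} → (m % d + n) % d ≡ (m + n) % d
[m%d+n]%d≡[m+n]%d m n d = begin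
  (m % d + n) % d ≡⟨ cong (_% d) (+-comm (m % d) n) ⟩
  (n + m % d) % d ≡⟨ [m+n%d]%d≡[m+n]%d n m d ⟩
  (n + m) % d     ≡⟨ cong (_% d) (+-comm n m) ⟩
  (m + n) % d     ∎
  where open ≡-Reasoning

[t+a]%d≡[t+b]%d⇒a≡b : ∀ t {a b d} .{{_ : NonZero d}} → a < d → b < d → (t + a) % d ≡ (t + b) % d → a ≡ b
[t+a]%d≡[t+b]%d⇒a≡b t {a} {b} {d@(suc d-1)} a<d b<d eq = begin
  a                           ≡⟨ m<n⇒m%n≡m a<d ⟨
  a % d                       ≡⟨ undo a ⟨
  ((t + a) % d + t * d-1) % d ≡⟨ cong (λ r → (r + t * d-1) % d) eq ⟩
  ((t + b) % d + t * d-1) % d ≡⟨ undo b ⟩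
  b % d                       ≡⟨ m<n⇒m%n≡m b<d ⟩
  b                           ∎
  where
  open ≡-Reasoning
  undo : ∀ x → ((t + x) % d + t * d-1) % d ≡ x % d
  undo x = begin
    ((t + x) % d + t * d-1) % d ≡⟨ [m%d+n]%d≡[m+n]%d (t + x) (t * d-1) d ⟩
    (t + x + t * d-1) % d       ≡⟨ cong (_% d) (+-assoc t x (t * d-1)) ⟩
    (t + (x + t * d-1)) % d     ≡⟨ cong (_% d) (+-comm t (x + t * d-1)) ⟩
    (x + t * d-1 + t) % d       ≡⟨ cong (_% d) (+-assoc x (t * d-1) t) ⟩
    (x + (t * d-1 + t)) % d     ≡⟨ cong (λ r → (x + r) % d) (trans (+-comm (t * d-1) t) (≡-sym (*-suc t d-1))) ⟩
    (x + t * d) % d             ≡⟨ [m+kn]%n≡m%n x t d ⟩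
    x % d                       ∎

∈⁅⁆ : ∀ {n} {x y : Fin n} → x ∈ ⁅ y ⁆ → x ≡ y
∈⁅⁆ {y = y} = x∈⁅y⁆⇒x≡y y

path₃ : ∀ {n} → Fin n → Fin n → Fin n → Subset n
path₃ a b c = (⁅ a ⁆ ∪ ⁅ c ⁆) ∪ ⁅ b ⁆

module _ {n} {a b c : Fin n} where

  left∈path₃ : a ∈ path₃ a b c
  left∈path₃ = x∈p∪q⁺ (inj₁ (x∈p∪q⁺ (inj₁ (x∈⁅x⁆ a))))

  middle∈path₃ : b ∈ path₃ a b c
  middle∈path₃ = x∈p∪q⁺ (inj₂ (x∈⁅x⁆ b))

  right∈path₃ : c ∈ path₃ a b c
  right∈path₃ = x∈p∪q⁺ (inj₁ (x∈p∪q⁺ (inj₂ (x∈⁅x⁆ c))))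

  ∈path₃⁺ : ∀ {t} → t ≡ a ⊎ t ≡ b ⊎ t ≡ c → t ∈ path₃ a b c
  ∈path₃⁺ (inj₁ refl)        = left∈path₃
  ∈path₃⁺ (inj₂ (inj₁ refl)) = middle∈path₃
  ∈path₃⁺ (inj₂ (inj₂ refl)) = right∈path₃

  ∈path₃⁻ : ∀ {t} → t ∈ path₃ a b c → t ≡ a ⊎ t ≡ b ⊎ t ≡ c
  ∈path₃⁻ t∈ with x∈p∪q⁻ (⁅ a ⁆ ∪ ⁅ c ⁆) ⁅ b ⁆ t∈
  ... | inj₂ t∈b = inj₂ (inj₁ (∈⁅⁆ t∈b))
  ... | inj₁ t∈ac with x∈p∪q⁻ ⁅ a ⁆ ⁅ c ⁆ t∈ac
  ...   | inj₁ t∈a = inj₁ (∈⁅⁆ t∈a)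
  ...   | inj₂ t∈c = inj₂ (inj₂ (∈⁅⁆ t∈c))

_≟ₛ_ : ∀ {n} → DecidableEquality (Subset n)
_≟ₛ_ = ≡-dec _≟ᵇ_

module Bicliques {n} (H : SimpleGraph n) where

  infix 4 _~_
  _~_ : Fin n → Fin n → Set
  _~_ = Adj H

  CompleteBip : Subset n → Set
  CompleteBip = InducesCompleteBipartite H

  Biclique : Subset n → Set
  Biclique = IsBiclique H

  Independent : Subset n → Set
  Independent X = ∀ {x y} → x ∈ X → y ∈ X → ¬ x ~ y

  Complete : Subset n → Subset n → Set
  Complete X Y = ∀ {x y} → x ∈ X → y ∈ Y → x ~ y

  complete⇒disjoint : ∀ {X Y} → Complete X Y → X ∩ Y ≡ ∅
  complete⇒disjoint X~Y = ⊆-antisym X∩Y⊆∅ (λ x∈∅ → ⊥-elim (∉⊥ x∈∅))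
    where
    X∩Y⊆∅ : _ ⊆ ∅
    X∩Y⊆∅ x∈X∩Y = let x∈X , x∈Y = x∈p∩q⁻ _ _ x∈X∩Y in ⊥-elim (irrefl H (X~Y x∈X x∈Y))

  completeBip : ∀ {X Y} → Nonempty X → Nonempty Y → Independent X → Independent Y → Complete X Y
              → CompleteBip (X ∪ Y)
  completeBip {X} {Y} nX nY iX iY X~Y = X , Y , nX , nY , complete⇒disjoint X~Y , refl , iX , iY , X~Y

  independent-⁅⁆ : ∀ {a} → Independent ⁅ a ⁆
  independent-⁅⁆ x∈a y∈a with ∈⁅⁆ x∈a | ∈⁅⁆ y∈a
  ... | refl | refl = irrefl H

  independent-∪⁅⁆ : ∀ {X z} → Independent X → (∀ {x} → x ∈ X → ¬ x ~ z) → Independent (X ∪ ⁅ z ⁆)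
  independent-∪⁅⁆ {X} {z} iX X≁z x∈ y∈ with x∈p∪q⁻ X ⁅ z ⁆ x∈ | x∈p∪q⁻ X ⁅ z ⁆ y∈
  ... | inj₁ x∈X | inj₁ y∈X = iX x∈X y∈X
  ... | inj₁ x∈X | inj₂ y∈z rewrite ∈⁅⁆ y∈z = X≁z x∈X
  ... | inj₂ x∈z | inj₁ y∈X rewrite ∈⁅⁆ x∈z = X≁z y∈X ∘ sym H
  ... | inj₂ x∈z | inj₂ y∈z = independent-⁅⁆ x∈z y∈z

  complete-⁅⁆ : ∀ {a b} → a ~ b → Complete ⁅ a ⁆ ⁅ b ⁆
  complete-⁅⁆ a~b x∈a y∈b rewrite ∈⁅⁆ x∈a | ∈⁅⁆ y∈b = a~b

  complete-∪⁅⁆ : ∀ {X Y z} → Complete X Y → (∀ {y} → y ∈ Y → z ~ y) → Complete (X ∪ ⁅ z ⁆) Y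
  complete-∪⁅⁆ {X} {Y} {z} X~Y z~Y x∈ y∈Y with x∈p∪q⁻ X ⁅ z ⁆ x∈
  ... | inj₁ x∈X = X~Y x∈X y∈Y
  ... | inj₂ x∈z rewrite ∈⁅⁆ x∈z = z~Y y∈Y

  edge-completeBip : ∀ {a b} → a ~ b → CompleteBip (⁅ a ⁆ ∪ ⁅ b ⁆)
  edge-completeBip {a} {b} a~b =
    completeBip (a , x∈⁅x⁆ a) (b , x∈⁅x⁆ b) independent-⁅⁆ independent-⁅⁆ (complete-⁅⁆ a~b)

  path₃-completeBip : ∀ {a b c} → b ~ a → b ~ c → ¬ a ~ c → CompleteBip (path₃ a b c)
  path₃-completeBip {a} {b} {c} b~a b~c a≁c =
    completeBip (a , x∈p∪q⁺ (inj₁ (x∈⁅x⁆ a))) (b , x∈⁅x⁆ b)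
      (independent-∪⁅⁆ independent-⁅⁆ λ x∈a → subst (λ x → ¬ x ~ c) (≡-sym (∈⁅⁆ x∈a)) a≁c)
      independent-⁅⁆
      (complete-∪⁅⁆ (complete-⁅⁆ (sym H b~a)) λ y∈b → subst (_ ~_) (≡-sym (∈⁅⁆ y∈b)) (sym H b~c))

  ∃-edge : ∀ {S} → CompleteBip S → ∃₂ λ u w → u ∈ S × w ∈ S × u ~ w
  ∃-edge (X , Y , (x , x∈X) , (y , y∈Y) , _ , refl , _ , _ , X~Y) =
    x , y , x∈p∪q⁺ (inj₁ x∈X) , x∈p∪q⁺ (inj₂ y∈Y) , X~Y x∈X y∈Y

  record Oriented (S : Subset n) (v : Fin n) : Set where
    field
      X Y       : Subset n
      v∈X       : v ∈ X
      nonemptyY : Nonempty Y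
      X⊆S       : X ⊆ S
      Y⊆S       : Y ⊆ S
      X∪Y⊇S     : ∀ {t} → t ∈ S → t ∈ X ⊎ t ∈ Y
      indepX    : Independent X
      indepY    : Independent Y
      X~Y       : Complete X Y

    ~⇒∈Y : ∀ {t} → t ∈ S → v ~ t → t ∈ Y
    ~⇒∈Y t∈S v~t with X∪Y⊇S t∈S
    ... | inj₁ t∈X = ⊥-elim (indepX v∈X t∈X v~t)
    ... | inj₂ t∈Y = t∈Y

    ≁⇒∈X : ∀ {t} → t ∈ S → ¬ v ~ t → t ∈ X
    ≁⇒∈X t∈S v≁t with X∪Y⊇S t∈S
    ... | inj₁ t∈X = t∈X
    ... | inj₂ t∈Y = ⊥-elim (v≁t (X~Y v∈X t∈Y))

  orient : ∀ {S v} → CompleteBip S → v ∈ S → Oriented S v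
  orient (X , Y , nX , nY , _ , refl , iX , iY , X~Y) v∈S with x∈p∪q⁻ X Y v∈S
  ... | inj₁ v∈X = record
    { X = X ; Y = Y ; v∈X = v∈X ; nonemptyY = nY
    ; X⊆S = x∈p∪q⁺ ∘ inj₁ ; Y⊆S = x∈p∪q⁺ ∘ inj₂ ; X∪Y⊇S = x∈p∪q⁻ X Y
    ; indepX = iX ; indepY = iY ; X~Y = X~Y }
  ... | inj₂ v∈Y = record
    { X = Y ; Y = X ; v∈X = v∈Y ; nonemptyY = nX
    ; X⊆S = x∈p∪q⁺ ∘ inj₂ ; Y⊆S = x∈p∪q⁺ ∘ inj₁ ; X∪Y⊇S = swap ∘ x∈p∪q⁻ X Y
    ; indepX = iY ; indepY = iX ; X~Y = λ y∈Y x∈X → sym H (X~Y x∈X y∈Y) }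

  module _ {S v t t′} (cb : CompleteBip S) (v∈S : v ∈ S) (t∈S : t ∈ S) (t′∈S : t′ ∈ S) where
    open Oriented (orient cb v∈S)

    ~∧~⇒≁ : v ~ t → v ~ t′ → ¬ t ~ t′
    ~∧~⇒≁ v~t v~t′ = indepY (~⇒∈Y t∈S v~t) (~⇒∈Y t′∈S v~t′)

    ~∧≁⇒~ : v ~ t → ¬ v ~ t′ → t ~ t′
    ~∧≁⇒~ v~t v≁t′ = sym H (X~Y (≁⇒∈X t′∈S v≁t′) (~⇒∈Y t∈S v~t))

    ≁∧≁⇒≁ : ¬ v ~ t → ¬ v ~ t′ → ¬ t ~ t′
    ≁∧≁⇒≁ v≁t v≁t′ = indepX (≁⇒∈X t∈S v≁t) (≁⇒∈X t′∈S v≁t′)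

  ∃-neighbour : ∀ {S v} → CompleteBip S → v ∈ S → ∃ λ t → t ∈ S × v ~ t
  ∃-neighbour cb v∈S = let (y , y∈Y) = nonemptyY in y , Y⊆S y∈Y , X~Y v∈X y∈Y
    where open Oriented (orient cb v∈S)

  extendToBiclique : ∀ {S} → CompleteBip S → ¬ ¬ (∃ λ T → Biclique T × S ⊆ T)
  extendToBiclique = go (⊃-wellFounded _)
    where
    go : ∀ {S} → Acc _⊃_ S → CompleteBip S → ¬ ¬ (∃ λ T → Biclique T × S ⊆ T)
    go {S} (acc larger) cbS noBiclique = ¬¬-excluded-middle {A = ∃ λ T → S ⊂ T × CompleteBip T} λ
      { (yes (T , S⊂T , cbT)) → go (larger S⊂T) cbT λ (U , bicU , T⊆U) →
          noBiclique (U , bicU , T⊆U ∘ proj₁ S⊂T)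
      ; (no noProperExtension) → noBiclique (S , (cbS , maximal noProperExtension) , id) }
      where
      maximal : ¬ (∃ λ T → S ⊂ T × CompleteBip T) → ∀ T → S ⊆ T → CompleteBip T → T ≡ S
      maximal noProperExtension T S⊆T cbT = ⊆-antisym T⊆S S⊆T
        where
        T⊆S : T ⊆ S
        T⊆S {x} x∈T with x ∈? S
        ... | yes x∈S = x∈S
        ... | no x∉S = ⊥-elim (noProperExtension (T , (S⊆T , x , x∈T , x∉S) , cbT))

  edge⊆biclique : ∀ {a b} → a ~ b → ¬ ¬ (∃ λ T → Biclique T × a ∈ T × b ∈ T)
  edge⊆biclique {a} {b} a~b none = extendToBiclique (edge-completeBip a~b) λ (T , bicT , ab⊆T) →
    none (T , bicT , ab⊆T (x∈p∪q⁺ (inj₁ (x∈⁅x⁆ a))) , ab⊆T (x∈p∪q⁺ (inj₂ (x∈⁅x⁆ b))))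

  path₃⊆biclique : ∀ {a b c} → b ~ a → b ~ c → ¬ a ~ c → ¬ ¬ (∃ λ T → Biclique T × a ∈ T × b ∈ T × c ∈ T)
  path₃⊆biclique b~a b~c a≁c none = extendToBiclique (path₃-completeBip b~a b~c a≁c) λ (T , bicT , abc⊆T) →
    none (T , bicT , abc⊆T left∈path₃ , abc⊆T middle∈path₃ , abc⊆T right∈path₃)

  twin∈biclique : ∀ {S v z} → Biclique S → v ∈ S
                → (∀ {t} → t ∈ S → v ~ t → z ~ t) → (∀ {t} → t ∈ S → ¬ v ~ t → ¬ z ~ t) → z ∈ S
  twin∈biclique {S} {v} {z} (cbS , maximal) v∈S v~⇒z~ v≁⇒z≁ =
    subst (z ∈_) (maximal T S⊆T cbT) (x∈p∪q⁺ (inj₁ (x∈p∪q⁺ (inj₂ (x∈⁅x⁆ z)))))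
    where
    open Oriented (orient cbS v∈S)
    T : Subset n
    T = (X ∪ ⁅ z ⁆) ∪ Y
    S⊆T : S ⊆ T
    S⊆T t∈S = x∈p∪q⁺ (map₁ (x∈p∪q⁺ ∘ inj₁) (X∪Y⊇S t∈S))
    cbT : CompleteBip T
    cbT = completeBip (v , x∈p∪q⁺ (inj₁ v∈X)) nonemptyY
      (independent-∪⁅⁆ indepX λ x∈X → v≁⇒z≁ (X⊆S x∈X) (indepX v∈X x∈X) ∘ sym H)
      indepY
      (complete-∪⁅⁆ X~Y λ y∈Y → v~⇒z~ (Y⊆S y∈Y) (X~Y v∈X y∈Y))

-- In KB(H), onlyBD says that the edge BD lies in no triangle.
module EdgeInNoTriangle {n} (H : SimpleGraph n) {B D : Subset n}
  (bicB : IsBiclique H B) (bicD : IsBiclique H D) {v : Fin n} (v∈B : v ∈ B) (v∈D : v ∈ D)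
  (onlyBD : ∀ {E} → IsBiclique H E → Nonempty (E ∩ B) → Nonempty (E ∩ D) → E ≡ B ⊎ E ≡ D) where

  open Bicliques H

  private
    cbB : CompleteBip B
    cbB = proj₁ bicB

    cbD : CompleteBip D
    cbD = proj₁ bicD

  BorD : Subset n → Set
  BorD E = E ≡ B ⊎ E ≡ D

  through-B∩D : ∀ {x E} → x ∈ B → x ∈ D → Biclique E → x ∈ E → BorD E
  through-B∩D {x} x∈B x∈D bicE x∈E = onlyBD bicE (x , x∈p∩q⁺ (x∈E , x∈B)) (x , x∈p∩q⁺ (x∈E , x∈D))

  B∩D-in-no-triangle : ∀ {w u u′} → w ∈ B → w ∈ D → w ~ u → w ~ u′ → ¬ u ~ u′
  B∩D-in-no-triangle {w} {u} {u′} w∈B w∈D w~u w~u′ u~u′ =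
    edge⊆biclique w~u λ (E₁ , bic₁ , w∈E₁ , u∈E₁) →
    edge⊆biclique w~u′ λ (E₂ , bic₂ , w∈E₂ , u′∈E₂) →
    edge⊆biclique u~u′ λ (E₃ , bic₃ , u∈E₃ , u′∈E₃) →
    triangleIn (together (through-B∩D w∈B w∈D bic₁ w∈E₁) (through-B∩D w∈B w∈D bic₂ w∈E₂)
                         u∈E₁ u′∈E₂ bic₃ u∈E₃ u′∈E₃)
    where
    together : ∀ {E₁ E₂ E₃} → BorD E₁ → BorD E₂ → u ∈ E₁ → u′ ∈ E₂ → Biclique E₃ → u ∈ E₃ → u′ ∈ E₃
             → ∃ λ E → BorD E × u ∈ E × u′ ∈ E
    together (inj₁ refl) (inj₁ refl) u∈B u′∈B _ _ _ = B , inj₁ refl , u∈B , u′∈B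
    together (inj₂ refl) (inj₂ refl) u∈D u′∈D _ _ _ = D , inj₂ refl , u∈D , u′∈D
    together {E₃ = E₃} (inj₁ refl) (inj₂ refl) u∈B u′∈D bic₃ u∈E₃ u′∈E₃ =
      E₃ , onlyBD bic₃ (u , x∈p∩q⁺ (u∈E₃ , u∈B)) (u′ , x∈p∩q⁺ (u′∈E₃ , u′∈D)) , u∈E₃ , u′∈E₃
    together {E₃ = E₃} (inj₂ refl) (inj₁ refl) u∈D u′∈B bic₃ u∈E₃ u′∈E₃ =
      E₃ , onlyBD bic₃ (u′ , x∈p∩q⁺ (u′∈E₃ , u′∈B)) (u , x∈p∩q⁺ (u∈E₃ , u∈D)) , u∈E₃ , u′∈E₃

    triangleIn : (∃ λ E → BorD E × u ∈ E × u′ ∈ E) → ⊥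
    triangleIn (_ , inj₁ refl , u∈B , u′∈B) = ~∧~⇒≁ cbB w∈B u∈B u′∈B w~u w~u′ u~u′
    triangleIn (_ , inj₂ refl , u∈D , u′∈D) = ~∧~⇒≁ cbD w∈D u∈D u′∈D w~u w~u′ u~u′

  Nᴰ⊆B : Set
  Nᴰ⊆B = ∀ {y} → y ∈ D → v ~ y → y ∈ B

  Nᴮ⊆D : Set
  Nᴮ⊆D = ∀ {y} → y ∈ B → v ~ y → y ∈ D

  -- Neighbours y ∈ B − D and y′ ∈ D − B of v would span with v an induced path whose
  -- biclique passes through v and is neither B nor D.
  ¬Nᴰ⊆B⇒Nᴮ⊆D : ¬ Nᴰ⊆B → Nᴮ⊆D
  ¬Nᴰ⊆B⇒Nᴮ⊆D ¬Nᴰ⊆B {y} y∈B v~y = decidable-stable (y ∈? D) λ y∉D → ¬Nᴰ⊆B λ {y′} y′∈D v~y′ →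
    decidable-stable (y′ ∈? B) λ y′∉B → crossing y∉D y′∉B (y′∈D , v~y′)
    where
    crossing : ∀ {y′} → y ∉ D → y′ ∉ B → y′ ∈ D × v ~ y′ → ⊥
    crossing {y′} y∉D y′∉B (y′∈D , v~y′) =
      path₃⊆biclique v~y v~y′ (B∩D-in-no-triangle v∈B v∈D v~y v~y′) λ (E , bicE , y∈E , v∈E , y′∈E) →
      [ (λ { refl → y′∉B y′∈E }) , (λ { refl → y∉D y∈E }) ]′ (through-B∩D v∈B v∈D bicE v∈E)

  Nᴰ⊆B⇒twin∈D : Nᴰ⊆B → ∀ {z} → z ∈ B → ¬ v ~ z → z ∈ D
  Nᴰ⊆B⇒twin∈D Nᴰ⊆B {z} z∈B v≁z = twin∈biclique bicD v∈D z~ z≁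
    where
    z~ : ∀ {t} → t ∈ D → v ~ t → z ~ t
    z~ t∈D v~t = sym H (~∧≁⇒~ cbB v∈B (Nᴰ⊆B t∈D v~t) z∈B v~t v≁z)
    z≁ : ∀ {t} → t ∈ D → ¬ v ~ t → ¬ z ~ t
    z≁ t∈D v≁t with ∃-neighbour cbD v∈D
    ... | w , w∈D , v~w =
      B∩D-in-no-triangle w∈B w∈D (~∧≁⇒~ cbB v∈B w∈B z∈B v~w v≁z) (~∧≁⇒~ cbD v∈D w∈D t∈D v~w v≁t)
      where w∈B = Nᴰ⊆B w∈D v~w

  module _ {C c} (bicC : Biclique C) (c∈C : c ∈ C) (c∈B : c ∈ B) (C-disjoint-D : ∀ {x} → x ∈ C → x ∉ D) where

    private
      cbC : CompleteBip C
      cbC = proj₁ bicC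

      c∉D : c ∉ D
      c∉D = C-disjoint-D c∈C

    C-neighbour-of-c∈B : ∀ {w z} → w ∈ B → w ∈ D → w ~ c → z ∈ C → c ~ z → z ∈ B
    C-neighbour-of-c∈B {w} {z} w∈B w∈D w~c z∈C c~z = decidable-stable (z ∈? B) λ z∉B →
      ¬¬-excluded-middle {A = w ~ z} λ
        { (yes w~z) → edge⊆biclique w~z λ (F , bicF , w∈F , z∈F) →
            adjacentCase (through-B∩D w∈B w∈D bicF w∈F) z∈F w~z
        ; (no w≁z) → path₃⊆biclique (sym H w~c) c~z w≁z λ (F , bicF , w∈F , c∈F , z∈F) →
            z∉B (nonadjacentCase (through-B∩D w∈B w∈D bicF w∈F) c∈F z∈F) }
      where
      adjacentCase : ∀ {F} → BorD F → z ∈ F → w ~ z → ⊥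
      adjacentCase (inj₁ refl) z∈B w~z = ~∧~⇒≁ cbB w∈B c∈B z∈B w~c w~z c~z
      adjacentCase (inj₂ refl) z∈D _ = C-disjoint-D z∈C z∈D

      nonadjacentCase : ∀ {F} → BorD F → c ∈ F → z ∈ F → z ∈ B
      nonadjacentCase (inj₁ refl) _ z∈B = z∈B
      nonadjacentCase (inj₂ refl) c∈D _ = ⊥-elim (c∉D c∈D)

    ¬Nᴰ⊆B : ¬ Nᴰ⊆B
    ¬Nᴰ⊆B Nᴰ⊆B = ¬¬-excluded-middle {A = v ~ c} λ
      { (no v≁c) → c∉D (Nᴰ⊆B⇒twin∈D Nᴰ⊆B c∈B v≁c)
      ; (yes v~c) → let z , z∈C , c~z = ∃-neighbour cbC c∈C
                        z∈B = C-neighbour-of-c∈B v∈B v∈D v~c z∈C c~z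
          in ¬¬-excluded-middle {A = v ~ z} λ
            { (yes v~z) → ~∧~⇒≁ cbB v∈B c∈B z∈B v~c v~z c~z
            ; (no v≁z) → C-disjoint-D z∈C (Nᴰ⊆B⇒twin∈D Nᴰ⊆B z∈B v≁z) } }

    ¬Nᴮ⊆D : ¬ Nᴮ⊆D
    ¬Nᴮ⊆D Nᴮ⊆D = ¬¬-excluded-middle {A = v ~ c} λ
      { (yes v~c) → c∉D (Nᴮ⊆D c∈B v~c)
      ; (no v≁c) → let w , w∈B , v~w = ∃-neighbour cbB v∈B
                       z , z∈C , c~z = ∃-neighbour cbC c∈C
                       w~c = ~∧≁⇒~ cbB v∈B w∈B c∈B v~w v≁c
                       z∈B = C-neighbour-of-c∈B w∈B (Nᴮ⊆D w∈B v~w) w~c z∈C c~z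
          in ¬¬-excluded-middle {A = v ~ z} λ
            { (yes v~z) → C-disjoint-D z∈C (Nᴮ⊆D z∈B v~z)
            ; (no v≁z) → ≁∧≁⇒≁ cbB v∈B c∈B z∈B v≁c v≁z c~z } }

  meets-B⇒meets-D : ∀ {C} → Biclique C → Nonempty (C ∩ B) → Nonempty (C ∩ D)
  meets-B⇒meets-D {C} bicC (c , c∈C∩B) with x∈p∩q⁻ C B c∈C∩B
  ... | c∈C , c∈B = decidable-stable (nonempty? (C ∩ D)) λ C∩D-empty →
    ¬Nᴮ⊆D bicC c∈C c∈B (disjoint C∩D-empty) (¬Nᴰ⊆B⇒Nᴮ⊆D (¬Nᴰ⊆B bicC c∈C c∈B (disjoint C∩D-empty)))
    where
    disjoint : ¬ Nonempty (C ∩ D) → ∀ {x} → x ∈ C → x ∉ D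
    disjoint C∩D-empty {x} x∈C x∈D = C∩D-empty (x , x∈p∩q⁺ (x∈C , x∈D))

module Cycle (k : ℕ) (7≤k : 7 ≤ k) where

  instance
    k-nonZero : NonZero k
    k-nonZero = >-nonZero (≤-trans (s≤s z≤n) 7≤k)

  Cₖ : SimpleGraph k
  Cₖ = cycle k (3≤7+ 7≤k)

  open Bicliques Cₖ

  next : Fin k → Fin k
  next i = fromℕ< (m%n<n (suc (toℕ i)) k)

  rotate : ℕ → Fin k → Fin k
  rotate zero    x = x
  rotate (suc d) x = next (rotate d x)

  toℕ-rotate : ∀ d x → toℕ (rotate d x) ≡ (toℕ x + d) % k
  toℕ-rotate zero x = begin
    toℕ x           ≡⟨ m<n⇒m%n≡m (toℕ<n x) ⟨
    toℕ x % k       ≡⟨ cong (_% k) (+-identityʳ (toℕ x)) ⟨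
    (toℕ x + 0) % k ∎
    where open ≡-Reasoning
  toℕ-rotate (suc d) x = begin
    toℕ (next (rotate d x))    ≡⟨ toℕ-fromℕ< _ ⟩
    (1 + toℕ (rotate d x)) % k ≡⟨ cong (λ r → (1 + r) % k) (toℕ-rotate d x) ⟩
    (1 + (toℕ x + d) % k) % k  ≡⟨ [m+n%d]%d≡[m+n]%d 1 (toℕ x + d) k ⟩
    (1 + (toℕ x + d)) % k      ≡⟨ cong (_% k) (+-suc (toℕ x) d) ⟨
    (toℕ x + suc d) % k        ∎
    where open ≡-Reasoning

  rotate-+ : ∀ a b x → rotate a (rotate b x) ≡ rotate (a + b) x
  rotate-+ zero    b x = refl
  rotate-+ (suc a) b x = cong next (rotate-+ a b x)

  rotate-injectiveˡ : ∀ {a b} x → a < k → b < k → rotate a x ≡ rotate b x → a ≡ b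
  rotate-injectiveˡ {a} {b} x a<k b<k eq =
    [t+a]%d≡[t+b]%d⇒a≡b (toℕ x) a<k b<k (trans (≡-sym (toℕ-rotate a x)) (trans (cong toℕ eq) (toℕ-rotate b x)))

  rotate-injectiveʳ : ∀ d {x y} → rotate d x ≡ rotate d y → x ≡ y
  rotate-injectiveʳ d {x} {y} eq = toℕ-injective ([t+a]%d≡[t+b]%d⇒a≡b d (toℕ<n x) (toℕ<n y) (begin
    (d + toℕ x) % k    ≡⟨ cong (_% k) (+-comm d (toℕ x)) ⟩
    (toℕ x + d) % k    ≡⟨ toℕ-rotate d x ⟨
    toℕ (rotate d x)   ≡⟨ cong toℕ eq ⟩
    toℕ (rotate d y)   ≡⟨ toℕ-rotate d y ⟩
    (toℕ y + d) % k    ≡⟨ cong (_% k) (+-comm (toℕ y) d) ⟩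
    (d + toℕ y) % k    ∎))
    where open ≡-Reasoning

  next-injective : ∀ {x y} → next x ≡ next y → x ≡ y
  next-injective = rotate-injectiveʳ 1

  rotate-k : ∀ x → rotate k x ≡ x
  rotate-k x = toℕ-injective (begin
    toℕ (rotate k x) ≡⟨ toℕ-rotate k x ⟩
    (toℕ x + k) % k  ≡⟨ [m+n]%n≡m%n (toℕ x) k ⟩
    toℕ x % k        ≡⟨ m<n⇒m%n≡m (toℕ<n x) ⟩
    toℕ x            ∎)
    where open ≡-Reasoning

  next-surjective : ∀ x → ∃ λ p → next p ≡ x
  next-surjective x =
    rotate (k ∸ 1) x , trans (cong (λ d → rotate d x) (m+[n∸m]≡n (≤-trans (s≤s z≤n) 7≤k))) (rotate-k x)

  offset-injective : ∀ {a b} x → a ≤ 6 → b ≤ 6 → rotate a x ≡ rotate b x → a ≡ b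
  offset-injective x a≤6 b≤6 = rotate-injectiveˡ x (≤-trans (s≤s a≤6) 7≤k) (≤-trans (s≤s b≤6) 7≤k)

  rotate≢id : ∀ {d} x → d ≤ 5 → rotate (suc d) x ≢ x
  rotate≢id x d≤5 eq with offset-injective x (s≤s d≤5) z≤n eq
  ... | ()

  Follows : Fin k → Fin k → Set
  Follows i j = suc (toℕ i) ≡ toℕ j ⊎ (suc (toℕ i) ≡ k × toℕ j ≡ 0)

  follows-next : ∀ i → Follows i (next i)
  follows-next i with m≤n⇒m<n∨m≡n (toℕ<n i)
  ... | inj₁ 1+i<k = inj₁ (≡-sym (trans (toℕ-fromℕ< _) (m<n⇒m%n≡m 1+i<k)))
  ... | inj₂ 1+i≡k = inj₂ (1+i≡k , trans (toℕ-fromℕ< _) (trans (cong (_% k) 1+i≡k) (n%n≡0 k)))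

  follows⇒≡next : ∀ {i j} → Follows i j → j ≡ next i
  follows⇒≡next {i} {j} i↦j = toℕ-injective (same i↦j (follows-next i))
    where
    same : ∀ {j j′} → Follows i j → Follows i j′ → toℕ j ≡ toℕ j′
    same (inj₁ e)       (inj₁ e′)       = trans (≡-sym e) e′
    same (inj₂ (_ , e)) (inj₂ (_ , e′)) = trans e (≡-sym e′)
    same {j} (inj₁ e) (inj₂ (1+i≡k , _)) = ⊥-elim (<⇒≢ (toℕ<n j) (trans (≡-sym e) 1+i≡k))
    same {j′ = j′} (inj₂ (1+i≡k , _)) (inj₁ e′) = ⊥-elim (<⇒≢ (toℕ<n j′) (trans (≡-sym e′) 1+i≡k))

  ~-next : ∀ i → i ~ next i
  ~-next i = [ inj₁ , inj₂ ∘ inj₂ ∘ inj₁ ]′ (follows-next i)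

  ~⇒next : ∀ {i j} → i ~ j → j ≡ next i ⊎ i ≡ next j
  ~⇒next (inj₁ e)               = inj₁ (follows⇒≡next (inj₁ e))
  ~⇒next (inj₂ (inj₁ e))        = inj₂ (follows⇒≡next (inj₁ e))
  ~⇒next (inj₂ (inj₂ (inj₁ e))) = inj₁ (follows⇒≡next (inj₂ e))
  ~⇒next (inj₂ (inj₂ (inj₂ e))) = inj₂ (follows⇒≡next (inj₂ e))

  next⇒~ : ∀ {i j} → j ≡ next i ⊎ i ≡ next j → i ~ j
  next⇒~ (inj₁ refl) = ~-next _
  next⇒~ (inj₂ refl) = sym Cₖ (~-next _)

  _~?_ : ∀ i j → Dec (i ~ j)
  i ~? j = map′ next⇒~ ~⇒next ((j ≟ next i) ⊎-dec (i ≟ next j))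

  arc : Fin k → Subset k
  arc x = path₃ x (next x) (rotate 2 x)

  ≁-rotate2 : ∀ x → ¬ x ~ rotate 2 x
  ≁-rotate2 x x~ with ~⇒next x~
  ... | inj₁ eq = rotate≢id x z≤n (next-injective eq)
  ... | inj₂ eq = rotate≢id x (s≤s (s≤s z≤n)) (≡-sym eq)

  three-consecutive⇒⊆arc : ∀ {S x} → CompleteBip S → x ∈ S → next x ∈ S → rotate 2 x ∈ S → S ⊆ arc x
  three-consecutive⇒⊆arc {S} {x} cb x∈S x₁∈S x₂∈S {u} u∈S = ∈path₃⁺ (position (next x ~? u))
    where
    position : Dec (next x ~ u) → u ≡ x ⊎ u ≡ next x ⊎ u ≡ rotate 2 x
    position (yes x₁~u) with ~⇒next x₁~u
    ... | inj₁ u≡x₂ = inj₂ (inj₂ u≡x₂)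
    ... | inj₂ x₁≡u₁ = inj₁ (≡-sym (next-injective x₁≡u₁))
    position (no x₁≁u)
      with ~⇒next (~∧≁⇒~ cb x₁∈S x∈S u∈S (sym Cₖ (~-next x)) x₁≁u)
         | ~⇒next (~∧≁⇒~ cb x₁∈S x₂∈S u∈S (~-next (next x)) x₁≁u)
    ... | inj₁ u≡x₁ | _               = inj₂ (inj₁ u≡x₁)
    ... | inj₂ _    | inj₂ x₂≡u₁      = inj₂ (inj₁ (≡-sym (next-injective x₂≡u₁)))
    ... | inj₂ x≡u₁ | inj₁ refl       = ⊥-elim (rotate≢id x (s≤s (s≤s (s≤s z≤n))) (≡-sym x≡u₁))

  no-predecessor⇒⊆arc : ∀ {S a} → CompleteBip S → a ∈ S → next a ∈ S → (∀ {t} → t ∈ S → next t ≢ a) → S ⊆ arc a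
  no-predecessor⇒⊆arc {S} {a} cb a∈S a₁∈S no-pred {u} u∈S = ∈path₃⁺ (position (a ~? u))
    where
    position : Dec (a ~ u) → u ≡ a ⊎ u ≡ next a ⊎ u ≡ rotate 2 a
    position (yes a~u) with ~⇒next a~u
    ... | inj₁ u≡a₁ = inj₂ (inj₁ u≡a₁)
    ... | inj₂ a≡u₁ = ⊥-elim (no-pred u∈S (≡-sym a≡u₁))
    position (no a≁u) with ~⇒next (~∧≁⇒~ cb a∈S a₁∈S u∈S (~-next a) a≁u)
    ... | inj₁ u≡a₂  = inj₂ (inj₂ u≡a₂)
    ... | inj₂ a₁≡u₁ = inj₁ (≡-sym (next-injective a₁≡u₁))

  arc-isBiclique : ∀ x → Biclique (arc x)
  arc-isBiclique x = cbArc , λ T arc⊆T cbT →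
    ⊆-antisym (three-consecutive⇒⊆arc cbT (arc⊆T left∈path₃) (arc⊆T middle∈path₃) (arc⊆T right∈path₃)) arc⊆T
    where
    cbArc : CompleteBip (arc x)
    cbArc = path₃-completeBip (sym Cₖ (~-next x)) (~-next (next x)) (≁-rotate2 x)

  biclique⇒arc : ∀ {S} → Biclique S → ∃ λ x → S ≡ arc x
  biclique⇒arc {S} (cbS , maximal) with ∃-edge cbS
  ... | u , w , u∈S , w∈S , u~w = fromEdge (~⇒next u~w)
    where
    arc-of : ∀ {x} → S ⊆ arc x → S ≡ arc x
    arc-of {x} S⊆arc = ≡-sym (maximal (arc x) S⊆arc (proj₁ (arc-isBiclique x)))

    fromConsecutive : ∀ {a} → a ∈ S → next a ∈ S → ∃ λ x → S ≡ arc x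
    fromConsecutive {a} a∈S a₁∈S with any? (λ t → (t ∈? S) ×-dec (next t ≟ a))
    ... | yes (t , t∈S , refl) = t , arc-of (three-consecutive⇒⊆arc cbS t∈S a∈S a₁∈S)
    ... | no no-pred = a , arc-of (no-predecessor⇒⊆arc cbS a∈S a₁∈S λ t∈S t₁≡a → no-pred (_ , t∈S , t₁≡a))

    fromEdge : w ≡ next u ⊎ u ≡ next w → ∃ λ x → S ≡ arc x
    fromEdge (inj₁ refl) = fromConsecutive u∈S w∈S
    fromEdge (inj₂ refl) = fromConsecutive w∈S u∈S

  ∈arc⇒offset : ∀ {t y} → t ∈ arc y → ∃ λ i → i ≤ 2 × t ≡ rotate i y
  ∈arc⇒offset t∈ with ∈path₃⁻ t∈
  ... | inj₁ refl        = 0 , z≤n , refl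
  ... | inj₂ (inj₁ refl) = 1 , s≤s z≤n , refl
  ... | inj₂ (inj₂ refl) = 2 , ≤-refl , refl

  module _ (P : Fin k) where

    ∈arc-rotate : ∀ {t r} → t ∈ arc (rotate r P) → ∃ λ i → i ≤ 2 × t ≡ rotate (i + r) P
    ∈arc-rotate {r = r} t∈ = let i , i≤2 , t≡ = ∈arc⇒offset t∈ in i , i≤2 , trans t≡ (rotate-+ i r P)

    rotate-a∈arc-b⇒b≤a : ∀ {a b} → a ≤ 4 → b ≤ 4 → rotate a P ∈ arc (rotate b P) → b ≤ a
    rotate-a∈arc-b⇒b≤a {a} {b} a≤4 b≤4 m with ∈arc-rotate m
    ... | i , i≤2 , eq =
      subst (b ≤_) (≡-sym (offset-injective P (≤-trans a≤4 (m≤n+m 4 2)) (+-mono-≤ i≤2 b≤4) eq)) (m≤n+m b i)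

    arc-offset-injective : ∀ {a b} → a ≤ 4 → b ≤ 4 → arc (rotate a P) ≡ arc (rotate b P) → a ≡ b
    arc-offset-injective a≤4 b≤4 eq = ≤-antisym
      (rotate-a∈arc-b⇒b≤a b≤4 a≤4 (subst (_ ∈_) (≡-sym eq) left∈path₃))
      (rotate-a∈arc-b⇒b≤a a≤4 b≤4 (subst (_ ∈_) eq left∈path₃))

    meets-arc⇒offset≤2 : ∀ {c t} → c ≤ 4 → t ∈ arc (rotate c P) → t ∈ arc P → c ≤ 2
    meets-arc⇒offset≤2 {c} c≤4 t∈arcᶜ t∈arc with ∈arc-rotate t∈arcᶜ | ∈arc⇒offset t∈arc
    ... | i , i≤2 , t≡ | j , j≤2 , t≡′ =
      ≤-trans (m≤n+m c i) (subst (_≤ 2) (≡-sym i+c≡j) j≤2)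
      where
      i+c≡j : i + c ≡ j
      i+c≡j = offset-injective P (+-mono-≤ i≤2 c≤4) (≤-trans j≤2 (m≤n+m 2 4)) (trans (≡-sym t≡) t≡′)

    meets-arc₀-and-arc₂⇒between : ∀ {S} → Biclique S → Nonempty (S ∩ arc (rotate 2 P)) → Nonempty (S ∩ arc P)
                        → S ≡ arc P ⊎ S ≡ arc (rotate 1 P) ⊎ S ≡ arc (rotate 2 P)
    meets-arc₀-and-arc₂⇒between {S} bicS (t , t∈S∩arc₂) (t′ , t′∈S∩arc) with biclique⇒arc bicS
    ... | y , refl with x∈p∩q⁻ S _ t∈S∩arc₂ | x∈p∩q⁻ S _ t′∈S∩arc
    ... | t∈S , t∈arc₂ | t′∈S , t′∈arc with ∈arc⇒offset t∈S | ∈arc-rotate t∈arc₂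
    ... | i , i≤2 , t≡ | j , j≤2 , t≡′ =
      offset≤2 (meets-arc⇒offset≤2 c≤4 (subst (λ z → t′ ∈ arc z) y≡ t′∈S) t′∈arc) y≡
      where
      c : ℕ
      c = (j + 2) ∸ i
      i+c≡j+2 : i + c ≡ j + 2
      i+c≡j+2 = m+[n∸m]≡n (≤-trans i≤2 (m≤n+m 2 j))
      c≤4 : c ≤ 4
      c≤4 = ≤-trans (m∸n≤m (j + 2) i) (+-mono-≤ j≤2 (≤-refl {2}))
      y≡ : y ≡ rotate c P
      y≡ = rotate-injectiveʳ i (begin
        rotate i y           ≡⟨ t≡ ⟨
        t                    ≡⟨ t≡′ ⟩
        rotate (j + 2) P     ≡⟨ cong (λ d → rotate d P) i+c≡j+2 ⟨
        rotate (i + c) P     ≡⟨ rotate-+ i c P ⟨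
        rotate i (rotate c P) ∎)
        where open ≡-Reasoning
      offset≤2 : ∀ {d} → d ≤ 2 → y ≡ rotate d P
               → arc y ≡ arc P ⊎ arc y ≡ arc (rotate 1 P) ⊎ arc y ≡ arc (rotate 2 P)
      offset≤2 {0}               _ refl = inj₁ refl
      offset≤2 {1}               _ refl = inj₂ (inj₁ refl)
      offset≤2 {2}               _ refl = inj₂ (inj₂ refl)
      offset≤2 {suc (suc (suc _))} (s≤s (s≤s ())) _

module DeletedArc (k : ℕ) (7≤k : 7 ≤ k) (P : Fin k) (q : V (KB (cycle k (3≤7+ 7≤k))))
  (q≡arc : proj₁ q ≡ Cycle.arc k 7≤k (Cycle.next k 7≤k P))
  {n} (H : SimpleGraph n) (iso : deleteVertex (KB (cycle k (3≤7+ 7≤k))) q ≅ KB H) where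

  open Cycle k 7≤k
  open _≅_ iso
  open Bicliques H using () renaming (Biclique to BicliqueH)

  G′ : Graph
  G′ = deleteVertex (KB Cₖ) q

  arcVertex : ∀ r → r ≤ 4 → r ≢ 1 → V G′
  arcVertex r r≤4 r≢1 = (arc (rotate r P) , arc-isBiclique _) ,
    λ arcʳ≡q → r≢1 (arc-offset-injective P r≤4 (s≤s z≤n) (trans arcʳ≡q q≡arc))

  3≤4 : 3 ≤ 4
  3≤4 = s≤s (s≤s (s≤s z≤n))

  vB vD vC : V G′
  vB = arcVertex 2 (s≤s (s≤s z≤n)) λ ()
  vD = arcVertex 0 z≤n λ ()
  vC = arcVertex 3 3≤4 λ ()

  image : V G′ → Subset n
  image = proj₁ ∘ f

  B D C : Subset n
  B = image vB
  D = image vD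
  C = image vC

  images-meet : ∀ u w {t} → proj₁ (proj₁ u) ≢ proj₁ (proj₁ w) → t ∈ proj₁ (proj₁ u) → t ∈ proj₁ (proj₁ w)
              → Nonempty (image u ∩ image w)
  images-meet u w {t} u≢w t∈u t∈w = proj₂ (edge→ {u} {w} (u≢w , t , x∈p∩q⁺ (t∈u , t∈w)))

  B∩D : Nonempty (B ∩ D)
  B∩D = images-meet vB vD ((λ ()) ∘ arc-offset-injective P (s≤s (s≤s z≤n)) z≤n) left∈path₃ right∈path₃

  C∩B : Nonempty (C ∩ B)
  C∩B = images-meet vC vB ((λ ()) ∘ arc-offset-injective P 3≤4 (s≤s (s≤s z≤n))) left∈path₃ middle∈path₃

  onlyBD : ∀ {E} → BicliqueH E → Nonempty (E ∩ B) → Nonempty (E ∩ D) → E ≡ B ⊎ E ≡ D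
  onlyBD {E} bicE E∩B E∩D = fromPreimage (surj (E , bicE)) (E ≟ₛ B) (E ≟ₛ D)
    where
    fromPreimage : (∃ λ e → image e ≡ E) → Dec (E ≡ B) → Dec (E ≡ D) → E ≡ B ⊎ E ≡ D
    fromPreimage _ (yes E≡B) _         = inj₁ E≡B
    fromPreimage _ (no _)    (yes E≡D) = inj₂ E≡D
    fromPreimage (e , fe≡E) (no E≢B) (no E≢D) = fromArc (meets-arc₀-and-arc₂⇒between P (proj₂ (proj₁ e))
        (proj₂ (edge← {e} {vB} (edgeTo E≢B E∩B))) (proj₂ (edge← {e} {vD} (edgeTo E≢D E∩D))))
      where
      edgeTo : ∀ {Z} → E ≢ Z → Nonempty (E ∩ Z) → image e ≢ Z × Nonempty (image e ∩ Z)
      edgeTo {Z} E≢Z E∩Z = E≢Z ∘ trans (≡-sym fe≡E) , subst (λ W → Nonempty (W ∩ Z)) (≡-sym fe≡E) E∩Z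

      fromArc : proj₁ (proj₁ e) ≡ arc P ⊎ proj₁ (proj₁ e) ≡ arc (rotate 1 P) ⊎ proj₁ (proj₁ e) ≡ arc (rotate 2 P)
              → E ≡ B ⊎ E ≡ D
      fromArc (inj₁ e≡arc⁰)        = inj₂ (trans (≡-sym fe≡E) (resp {e} {vD} e≡arc⁰))
      fromArc (inj₂ (inj₁ e≡q))    = ⊥-elim (proj₂ e (trans e≡q (≡-sym q≡arc)))
      fromArc (inj₂ (inj₂ e≡arc²)) = inj₁ (trans (≡-sym fe≡E) (resp {e} {vB} e≡arc²))

  C∩D-empty : ¬ Nonempty (C ∩ D)
  C∩D-empty (y , y∈C∩D) = fromDec (C ≟ₛ D)
    where
    fromDec : Dec (C ≡ D) → ⊥
    fromDec (yes C≡D) = 3≢0 (arc-offset-injective P 3≤4 z≤n (inj {vC} {vD} C≡D))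
      where
      3≢0 : 3 ≢ 0
      3≢0 ()
    fromDec (no C≢D) = let t , t∈arc³∩arc = proj₂ (edge← {vC} {vD} (C≢D , y , y∈C∩D)) in
      <⇒≱ ≤-refl (meets-arc⇒offset≤2 P 3≤4 (proj₁ (x∈p∩q⁻ _ _ t∈arc³∩arc)) (proj₂ (x∈p∩q⁻ _ _ t∈arc³∩arc)))

  impossible : ⊥
  impossible = C∩D-empty (EdgeInNoTriangle.meets-B⇒meets-D H (proj₂ (f vB)) (proj₂ (f vD))
    (proj₁ (x∈p∩q⁻ B D (proj₂ B∩D))) (proj₂ (x∈p∩q⁻ B D (proj₂ B∩D))) onlyBD (proj₂ (f vC)) C∩B)

mainTheorem2 : (k : ℕ) (h : 7 ≤ k) (q : V (KB (cycle k (3≤7+ h))))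
    → ¬ IsBicliqueGraph (deleteVertex (KB (cycle k (3≤7+ h))) q)
mainTheorem2 k h q (n , H , iso) =
  let x , q≡arcˣ = Cycle.biclique⇒arc k h (proj₂ q)
      P , nextP≡x = Cycle.next-surjective k h x
  in DeletedArc.impossible k h P q (trans q≡arcˣ (cong (Cycle.arc k h) (≡-sym nextP≡x))) H iso
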